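{- Let $\mathcal{A}=(S,A)$ and $\mathcal{B}=(S,B)$ be reactantless reaction systems (in $\mathcal{RS}(0,\infty)$) over the same background set $S$. If $\mathrm{res}_{\mathcal{A}}(S\setminus I_a)\subseteq\mathrm{res}_{\mathcal{B}}(S\setminus I_a)$ for every reaction $a=(R_a,I_a,P_a)\in A$, then $\mathrm{res}_{\mathcal{A}}(T)\subseteq\mathrm{res}_{\mathcal{B}}(T)$ for every state $T\subseteq S$.
   Context: A reaction over a finite set $S$ is a triple $a=(R_a,I_a,P_a)$ of subsets of $S$ (reactants, inhibitors, products) with $P_a\neq\varnothing$. A reaction system is a pair $\mathcal{A}=(S,A)$ with $S$ a finite background set and $A$ a set of reactions over $S$. A reaction $a$ is enabled in a state $T\subseteq S$ if $R_a\subseteq T$ and $I_a\cap T=\varnothing$. The result function is $\mathrm{res}_{\mathcal{A}}(T)=\bigcup\{P_a : a\in A \text{ enabled in } T\}$. $\mathcal{RS}(0,\infty)$ (reactantless systems) is the class of reaction systems in which every reaction has $R_a=\varnothing$. -}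

module Defs where

open import Data.Nat using (ℕ)
open import Data.Fin using (Fin)
open import Data.Fin.Subset using (Subset; _⊆_; _∈_; _∩_; ⊥; Nonempty; ∁)
open import Data.List using (List)
open import Data.List.Membership.Propositional renaming (_∈_ to _∈ₗ_)
open import Data.Product using (Σ; _×_; ∃)
open import Relation.Binary.PropositionalEquality using (_≡_)

-- Background set S = Fin n; subsets of S are `Subset n`.
record Reaction (n : ℕ) : Set where
  constructor reaction
  field
    R : Subset n
    I : Subset n
    P : Subset n
    P-nonempty : Nonempty P
open Reaction public

ReactionSystem : ℕ → Set
ReactionSystem n = List (Reaction n)

Reactantless : ∀ {n} → ReactionSystem n → Set
Reactantless {n} A = ∀ a → a ∈ₗ A → R a ≡ ⊥

Enabled : ∀ {n} → Reaction n → Subset n → Set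
Enabled a T = (R a ⊆ T) × (I a ∩ T ≡ ⊥)

_∈res[_]_ : ∀ {n} → Fin n → ReactionSystem n → Subset n → Set
x ∈res[ A ] T = Σ _ λ a → (a ∈ₗ A) × Enabled a T × (x ∈ P a)

ResSub : ∀ {n} → ReactionSystem n → ReactionSystem n → Subset n → Set
ResSub A B T = ∀ x → x ∈res[ A ] T → x ∈res[ B ] T

-- In a reactantless system a reaction is enabled in T exactly when T avoids its
-- inhibitors, so enabledness is antitone in the state. A reaction a of A enabled
-- in T is therefore enabled in the largest such state ∁ (I a); the hypothesis
-- yields a reaction b of B enabled in ∁ (I a) producing the same element, and
-- since T ⊆ ∁ (I a), b is enabled in T as well.
module Submission where

open import Defs
open import Data.Nat using (ℕ)
open import Data.Fin.Subset using (Subset; ∁; _∩_; ⊥; _⊆_; _∈_)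
open import Data.Fin.Subset.Properties using (⊥⊆; ∉⊥; x∈p∩q⁺; x∈p∩q⁻; x∉p⇒x∈∁p; x∈∁p⇒x∉p; Empty-unique; ⊆-refl; ⊆-trans)
open import Data.List.Membership.Propositional using () renaming (_∈_ to _∈ₗ_)
open import Data.Product using (_,_)
open import Relation.Binary.PropositionalEquality using (_≡_; subst; sym)

module _ {n : ℕ} where

  disjoint⇒⊆∁ : {p t : Subset n} → p ∩ t ≡ ⊥ → t ⊆ ∁ p
  disjoint⇒⊆∁ p∩t≡⊥ x∈t = x∉p⇒x∈∁p λ x∈p → ∉⊥ (subst (_ ∈_) p∩t≡⊥ (x∈p∩q⁺ (x∈p , x∈t)))

  ⊆∁⇒disjoint : (p t : Subset n) → t ⊆ ∁ p → p ∩ t ≡ ⊥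
  ⊆∁⇒disjoint p t t⊆∁p = Empty-unique λ (x , x∈p∩t) →
    let (x∈p , x∈t) = x∈p∩q⁻ p t x∈p∩t in x∈∁p⇒x∉p (t⊆∁p x∈t) x∈p

  module _ (a : Reaction n) (R≡⊥ : R a ≡ ⊥) where

    enabled-if-⊆∁I : {T : Subset n} → T ⊆ ∁ (I a) → Enabled a T
    enabled-if-⊆∁I {T} T⊆∁I = subst (_⊆ T) (sym R≡⊥) ⊥⊆ , ⊆∁⇒disjoint (I a) T T⊆∁I

    enabled-antitone : {T U : Subset n} → T ⊆ U → Enabled a U → Enabled a T
    enabled-antitone T⊆U (_ , I∩U≡⊥) = enabled-if-⊆∁I (⊆-trans T⊆U (disjoint⇒⊆∁ I∩U≡⊥))

proposition2 : (n : ℕ) (A B : ReactionSystem n) →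
    Reactantless A → Reactantless B →
    (∀ a → a ∈ₗ A → ResSub A B (∁ (I a))) →
    ∀ (T : Subset n) → ResSub A B T
proposition2 n A B reactantless-A reactantless-B res-I T x (a , a∈A , (_ , Iₐ∩T≡⊥) , x∈Pₐ)
  with res-I a a∈A x (a , a∈A , enabled-if-⊆∁I a (reactantless-A a a∈A) ⊆-refl , x∈Pₐ)
... | b , b∈B , b-enabled , x∈P_b =
  b , b∈B , enabled-antitone b (reactantless-B b b∈B) (disjoint⇒⊆∁ Iₐ∩T≡⊥) b-enabled , x∈P_b
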